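{- The rule $(\supset_{r1})$ is invertible in $\mathsf{LNIF}$: if $\mathcal{G}/\!/\Gamma\vdash\Delta,A\supset B$ is derivable in $\mathsf{LNIF}$ (where $\Gamma\vdash\Delta,A\supset B$ is the last component), then $\mathcal{G}/\!/\Gamma\vdash\Delta/\!/A\vdash B$ is derivable in $\mathsf{LNIF}$.
   Context: Formulae are first-order over $\bot,\land,\lor,\supset,\forall,\exists$; in sequents bound variables $x,y,\dots$ are distinct from parameters $a,b,\dots$, which occupy all free positions; $A[a/x]$ replaces free occurrences of $x$ by $a$; $p(\vec a)$ is an atomic formula with parameters $\vec a$. A linear nested sequent is $\Gamma_1\vdash\Delta_1 /\!/ \cdots /\!/ \Gamma_n\vdash\Delta_n$ ($n\ge1$), each $\Gamma_i,\Delta_i$ a finite, possibly empty, multiset of formulae (a component). In rule schemas, $\mathcal{G},\mathcal{H},\mathcal{F}$ denote possibly empty sequences of components. $\mathsf{LNIF}$ has the rules (from premise(s) infer conclusion): Initial: $(id_1)$ $\mathcal{G}/\!/\Gamma,p(\vec a)\vdash p(\vec a),\Delta/\!/\mathcal{H}$; $(id_2)$ $\mathcal{G}/\!/\Gamma_1,p(\vec a)\vdash\Delta_1/\!/\mathcal{H}/\!/\Gamma_2\vdash p(\vec a),\Delta_2/\!/\mathcal{F}$; $(\bot_l)$ $\mathcal{G}/\!/\Gamma,\bot\vdash\Delta/\!/\mathcal{H}$. $(\land_l)$: from $\mathcal{G}/\!/\Gamma,A,B\vdash\Delta/\!/\mathcal{H}$ infer $\mathcal{G}/\!/\Gamma,A\land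 B\vdash\Delta/\!/\mathcal{H}$. $(\lor_r)$: from $\mathcal{G}/\!/\Gamma\vdash\Delta,A,B/\!/\mathcal{H}$ infer $\mathcal{G}/\!/\Gamma\vdash\Delta,A\lor B/\!/\mathcal{H}$. $(\land_r)$: from $\mathcal{G}/\!/\Gamma\vdash\Delta,A/\!/\mathcal{H}$ and $\mathcal{G}/\!/\Gamma\vdash\Delta,B/\!/\mathcal{H}$ infer $\mathcal{G}/\!/\Gamma\vdash\Delta,A\land B/\!/\mathcal{H}$. $(\lor_l)$: from $\mathcal{G}/\!/\Gamma,A\vdash\Delta/\!/\mathcal{H}$ and $\mathcal{G}/\!/\Gamma,B\vdash\Delta/\!/\mathcal{H}$ infer $\mathcal{G}/\!/\Gamma,A\lor B\vdash\Delta/\!/\mathcal{H}$. $(\supset_{r1})$: from $\mathcal{G}/\!/\Gamma\vdash\Delta/\!/A\vdash B$ infer $\mathcal{G}/\!/\Gamma\vdash\Delta,A\supset B$. $(\supset_l)$: from $\mathcal{G}/\!/\Gamma,B\vdash\Delta/\!/\mathcal{H}$ and $\mathcal{G}/\!/\Gamma,A\supset B\vdash A,\Delta/\!/\mathcal{H}$ infer $\mathcal{G}/\!/\Gamma,A\supset B\vdash\Delta/\!/\mathcal{H}$. $(lift)$: from $\mathcal{G}/\!/\Gamma_1,A\vdash\Delta_1/\!/\Gamma_2,A\vdash\Delta_2/\!/\mathcal{H}$ infer $\mathcal{G}/\!/\Gamma_1,A\vdash\Delta_1/\!/\Gamma_2\vdash\Delta_2/\!/\mathcal{H}$. $(\forall_l)$: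 from $\mathcal{G}/\!/\Gamma,A[a/x],\forall xA\vdash\Delta/\!/\mathcal{H}$ infer $\mathcal{G}/\!/\Gamma,\forall xA\vdash\Delta/\!/\mathcal{H}$ ($a$ any parameter). $(\forall_{r1})$: from $\mathcal{G}/\!/\Gamma\vdash\Delta/\!/\ \vdash A[a/x]$ infer $\mathcal{G}/\!/\Gamma\vdash\Delta,\forall xA$. $(\exists_l)$: from $\mathcal{G}/\!/\Gamma,A[a/x]\vdash\Delta/\!/\mathcal{H}$ infer $\mathcal{G}/\!/\Gamma,\exists xA\vdash\Delta/\!/\mathcal{H}$. $(\exists_r)$: from $\mathcal{G}/\!/\Gamma\vdash A[a/x],\exists xA,\Delta/\!/\mathcal{H}$ infer $\mathcal{G}/\!/\Gamma\vdash\exists xA,\Delta/\!/\mathcal{H}$ ($a$ any parameter). $(\supset_{r2})$: from $\mathcal{G}/\!/\Gamma_1\vdash\Delta_1/\!/A\vdash B/\!/\Gamma_2\vdash\Delta_2/\!/\mathcal{H}$ and $\mathcal{G}/\!/\Gamma_1\vdash\Delta_1/\!/\Gamma_2\vdash\Delta_2,A\supset B/\!/\mathcal{H}$ infer $\mathcal{G}/\!/\Gamma_1\vdash\Delta_1,A\supset B/\!/\Gamma_2\vdash\Delta_2/\!/\mathcal{H}$. $(\forall_{r2})$: from $\mathcal{G}/\!/\Gamma_1\vdash\Delta_1/\!/\ \vdash A[a/x]/\!/\Gamma_2\vdash\Delta_2/\!/\mathcal{H}$ and $\mathcal{G}/\!/\Gamma_1\vdash\Delta_1/\!/\Gamma_2\vdash\Delta_2,\forall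 xA/\!/\mathcal{H}$ infer $\mathcal{G}/\!/\Gamma_1\vdash\Delta_1,\forall xA/\!/\Gamma_2\vdash\Delta_2/\!/\mathcal{H}$. In $(\forall_{r1}),(\exists_l),(\forall_{r2})$, $a$ is an eigenvariable (does not occur in the conclusion). -}

module Defs where

open import Data.Nat using (ℕ; zero; suc)
open import Data.Fin using (Fin; zero; suc)
open import Data.List using (List; []; _∷_; _++_; map)
open import Data.List.Relation.Unary.Any using (Any)
open import Data.List.Membership.Propositional using (_∈_)
open import Data.List.Relation.Binary.Permutation.Propositional using (_↭_)
open import Data.Product using (_×_; _,_)
open import Data.Sum using (_⊎_)
open import Data.Empty using (⊥)
open import Relation.Binary.PropositionalEquality using (_≡_)
open import Relation.Nullary using (¬_)

-- Bound variables are de Bruijn indices (Fin n, n = number of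
-- binders in scope); parameters are natural numbers.  Formulae occurring
-- in sequents have type Formula 0, so parameters occupy all free
-- positions, as in the paper.

Param : Set
Param = ℕ

data Term (n : ℕ) : Set where
  var : Fin n → Term n
  par : Param → Term n

infixr 6 _∧ᶠ_
infixr 5 _∨ᶠ_
infixr 4 _⊃_

data Formula (n : ℕ) : Set where
  atom  : ℕ → List (Term n) → Formula n
  ⊥ᶠ    : Formula n
  _∧ᶠ_  : Formula n → Formula n → Formula n
  _∨ᶠ_  : Formula n → Formula n → Formula n
  _⊃_   : Formula n → Formula n → Formula n
  ∀ᶠ    : Formula (suc n) → Formula n
  ∃ᶠ    : Formula (suc n) → Formula n

wkT : ∀ {n} → Term n → Term (suc n)
wkT (var i) = var (suc i)
wkT (par a) = par a

liftσ : ∀ {m n} → (Fin m → Term n) → Fin (suc m) → Term (suc n)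
liftσ σ zero    = var zero
liftσ σ (suc i) = wkT (σ i)

substT : ∀ {m n} → (Fin m → Term n) → Term m → Term n
substT σ (var i) = σ i
substT σ (par a) = par a

substF : ∀ {m n} → (Fin m → Term n) → Formula m → Formula n
substF σ (atom p ts) = atom p (map (substT σ) ts)
substF σ ⊥ᶠ          = ⊥ᶠ
substF σ (A ∧ᶠ B)    = substF σ A ∧ᶠ substF σ B
substF σ (A ∨ᶠ B)    = substF σ A ∨ᶠ substF σ B
substF σ (A ⊃ B)     = substF σ A ⊃ substF σ B
substF σ (∀ᶠ A)      = ∀ᶠ (substF (liftσ σ) A)
substF σ (∃ᶠ A)      = ∃ᶠ (substF (liftσ σ) A)

instσ : ∀ {n} → Param → Fin (suc n) → Term n
instσ a zero    = par a
instσ a (suc i) = var i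

-- A [ a /x] : for ∀x A / ∃x A (A with the outermost bound variable x free),
-- replace the free occurrences of x by the parameter a.
_[_/x] : ∀ {n} → Formula (suc n) → Param → Formula n
A [ a /x] = substF (instσ a) A

occT : ∀ {n} → Param → Term n → Set
occT a (var i) = ⊥
occT a (par b) = a ≡ b

occF : ∀ {n} → Param → Formula n → Set
occF a (atom p ts) = Any (occT a) ts
occF a ⊥ᶠ          = ⊥
occF a (A ∧ᶠ B)    = occF a A ⊎ occF a B
occF a (A ∨ᶠ B)    = occF a A ⊎ occF a B
occF a (A ⊃ B)     = occF a A ⊎ occF a B
occF a (∀ᶠ A)      = occF a A
occF a (∃ᶠ A)      = occF a A

-- A component Γ ⊢ Δ is a pair of lists of
-- closed formulae, read as multisets (every rule matches its principal
-- formula up to permutation, _↭_).  A linear nested sequent is the list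
-- of its components (G // c₁ // … ; derivable ones are never empty).

Fm : Set
Fm = Formula 0

Comp : Set
Comp = List Fm × List Fm

LNS : Set
LNS = List Comp

occC : Param → Comp → Set
occC a (Γ , Δ) = Any (occF a) Γ ⊎ Any (occF a) Δ

occS : Param → LNS → Set
occS a S = Any (occC a) S

Fresh : Param → LNS → Set
Fresh a S = ¬ occS a S

data LNIF : LNS → Set where
  id₁ : ∀ {G H Γ Δ p ts} → atom p ts ∈ Γ → atom p ts ∈ Δ →
        LNIF (G ++ (Γ , Δ) ∷ H)
  id₂ : ∀ {G H F Γ₁ Δ₁ Γ₂ Δ₂ p ts} → atom p ts ∈ Γ₁ → atom p ts ∈ Δ₂ →
        LNIF (G ++ (Γ₁ , Δ₁) ∷ H ++ (Γ₂ , Δ₂) ∷ F)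
  ⊥ₗ  : ∀ {G H Γ Δ} → ⊥ᶠ ∈ Γ → LNIF (G ++ (Γ , Δ) ∷ H)
  ∧ₗ  : ∀ {G H Γ Γ' Δ A B} → Γ ↭ (A ∧ᶠ B) ∷ Γ' →
        LNIF (G ++ (A ∷ B ∷ Γ' , Δ) ∷ H) →
        LNIF (G ++ (Γ , Δ) ∷ H)
  ∨ᵣ  : ∀ {G H Γ Δ Δ' A B} → Δ ↭ (A ∨ᶠ B) ∷ Δ' →
        LNIF (G ++ (Γ , A ∷ B ∷ Δ') ∷ H) →
        LNIF (G ++ (Γ , Δ) ∷ H)
  ∧ᵣ  : ∀ {G H Γ Δ Δ' A B} → Δ ↭ (A ∧ᶠ B) ∷ Δ' →
        LNIF (G ++ (Γ , A ∷ Δ') ∷ H) →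
        LNIF (G ++ (Γ , B ∷ Δ') ∷ H) →
        LNIF (G ++ (Γ , Δ) ∷ H)
  ∨ₗ  : ∀ {G H Γ Γ' Δ A B} → Γ ↭ (A ∨ᶠ B) ∷ Γ' →
        LNIF (G ++ (A ∷ Γ' , Δ) ∷ H) →
        LNIF (G ++ (B ∷ Γ' , Δ) ∷ H) →
        LNIF (G ++ (Γ , Δ) ∷ H)
  ⊃ᵣ₁ : ∀ {G Γ Δ Δ' A B} → Δ ↭ (A ⊃ B) ∷ Δ' →
        LNIF (G ++ (Γ , Δ') ∷ (A ∷ [] , B ∷ []) ∷ []) →
        LNIF (G ++ (Γ , Δ) ∷ [])
  ⊃ₗ  : ∀ {G H Γ Γ' Δ A B} → Γ ↭ (A ⊃ B) ∷ Γ' →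
        LNIF (G ++ (B ∷ Γ' , Δ) ∷ H) →
        LNIF (G ++ ((A ⊃ B) ∷ Γ' , A ∷ Δ) ∷ H) →
        LNIF (G ++ (Γ , Δ) ∷ H)
  lift : ∀ {G H Γ₁ Δ₁ Γ₂ Δ₂ A} → A ∈ Γ₁ →
        LNIF (G ++ (Γ₁ , Δ₁) ∷ (A ∷ Γ₂ , Δ₂) ∷ H) →
        LNIF (G ++ (Γ₁ , Δ₁) ∷ (Γ₂ , Δ₂) ∷ H)
  ∀ₗ  : ∀ {G H Γ Γ' Δ A} (a : Param) → Γ ↭ ∀ᶠ A ∷ Γ' →
        LNIF (G ++ (A [ a /x] ∷ ∀ᶠ A ∷ Γ' , Δ) ∷ H) →
        LNIF (G ++ (Γ , Δ) ∷ H)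
  ∀ᵣ₁ : ∀ {G Γ Δ Δ' A} (a : Param) → Δ ↭ ∀ᶠ A ∷ Δ' →
        Fresh a (G ++ (Γ , Δ) ∷ []) →
        LNIF (G ++ (Γ , Δ') ∷ ([] , A [ a /x] ∷ []) ∷ []) →
        LNIF (G ++ (Γ , Δ) ∷ [])
  ∃ₗ  : ∀ {G H Γ Γ' Δ A} (a : Param) → Γ ↭ ∃ᶠ A ∷ Γ' →
        Fresh a (G ++ (Γ , Δ) ∷ H) →
        LNIF (G ++ (A [ a /x] ∷ Γ' , Δ) ∷ H) →
        LNIF (G ++ (Γ , Δ) ∷ H)
  ∃ᵣ  : ∀ {G H Γ Δ Δ' A} (a : Param) → Δ ↭ ∃ᶠ A ∷ Δ' →
        LNIF (G ++ (Γ , A [ a /x] ∷ ∃ᶠ A ∷ Δ') ∷ H) →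
        LNIF (G ++ (Γ , Δ) ∷ H)
  ⊃ᵣ₂ : ∀ {G H Γ₁ Δ₁ Δ₁' Γ₂ Δ₂ A B} → Δ₁ ↭ (A ⊃ B) ∷ Δ₁' →
        LNIF (G ++ (Γ₁ , Δ₁') ∷ (A ∷ [] , B ∷ []) ∷ (Γ₂ , Δ₂) ∷ H) →
        LNIF (G ++ (Γ₁ , Δ₁') ∷ (Γ₂ , (A ⊃ B) ∷ Δ₂) ∷ H) →
        LNIF (G ++ (Γ₁ , Δ₁) ∷ (Γ₂ , Δ₂) ∷ H)
  ∀ᵣ₂ : ∀ {G H Γ₁ Δ₁ Δ₁' Γ₂ Δ₂ A} (a : Param) → Δ₁ ↭ ∀ᶠ A ∷ Δ₁' →
        Fresh a (G ++ (Γ₁ , Δ₁) ∷ (Γ₂ , Δ₂) ∷ H) →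
        LNIF (G ++ (Γ₁ , Δ₁') ∷ ([] , A [ a /x] ∷ []) ∷ (Γ₂ , Δ₂) ∷ H) →
        LNIF (G ++ (Γ₁ , Δ₁') ∷ (Γ₂ , ∀ᶠ A ∷ Δ₂) ∷ H) →
        LNIF (G ++ (Γ₁ , Δ₁) ∷ (Γ₂ , Δ₂) ∷ H)

-- We prove a stronger invertibility: A ⊃ B may be removed from the succedent of any
-- component while a component with A in its antecedent and B in its succedent is
-- inserted anywhere to its right.  Induction on the derivation needs this generality,
-- since ⊃ᵣ₂ and ∀ᵣ₂ create components between the two, and lift can move formulae into
-- the new one.  When A ⊃ B is principal, a premise of ⊃ᵣ₁ / ⊃ᵣ₂ is the required sequent
-- up to weakening.  A ⊃ᵣ₁ or ∀ᵣ₁ acting just before the inserted component becomes the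
-- corresponding ⊃ᵣ₂ or ∀ᵣ₂ across it, followed by the original rule on it; lift, ⊃ᵣ₂ and
-- ∀ᵣ₂ acting across the insertion point are applied twice in the same way; every other
-- rule commutes.  Eigenvariable conditions are handled in a variant of the calculus whose
-- eigenvariable rules have a premise for every fresh parameter; it is equivalent to LNIF
-- because transposing two parameters that do not occur in the conclusion of a derivation
-- yields a derivation of the same conclusion.

module Submission where

open import Defs
open import Data.Nat using (ℕ; suc; _≟_; _≤_; _⊔_)
open import Data.Nat.Properties using (≤-refl; m≤n⇒m≤n⊔o; m≤n⇒m≤o⊔n; n≮n)
open import Data.Fin using (Fin; zero; suc)
open import Data.List using (List; []; _∷_; _++_; map)
open import Data.List.Properties using (++-assoc; ++-identityʳ; map-cong; map-∘; map-id-local)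
open import Data.List.Relation.Unary.All as All using ()
open import Data.List.Relation.Unary.Any as Any using (Any; here; there)
import Data.List.Relation.Unary.Any.Properties as Any
open import Data.List.Membership.Propositional using (_∈_; lose)
open import Data.List.Membership.Propositional.Properties using (∈-∃++; ∈-map⁺)
open import Data.List.Relation.Binary.Permutation.Propositional
  using (_↭_; ↭-refl; ↭-sym; ↭-trans; ↭-prep; ↭-swap; ↭-reflexive)
open import Data.List.Relation.Binary.Permutation.Propositional.Properties
  using (∈-resp-↭; Any-resp-↭; shift; drop-∷; ++⁺ˡ; ++⁺ʳ; map⁺)
open import Data.List.Relation.Binary.Pointwise as Pointwise using (Pointwise; []; _∷_)
open import Data.Product using (∃; _×_; _,_; proj₁; proj₂)
open import Data.Sum using (_⊎_; inj₁; inj₂; [_,_]′)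
open import Data.Empty using (⊥-elim)
open import Function using (id; _∘_)
open import Relation.Nullary using (yes; no)
open import Relation.Binary.PropositionalEquality
  using (_≡_; _≢_; _≗_; refl; sym; trans; cong; cong₂; subst)

∈⇒↭∷ : ∀ {E : Set} {x : E} {xs} → x ∈ xs → ∃ λ ys → xs ↭ x ∷ ys
∈⇒↭∷ {x = x} x∈xs with ys , zs , refl ← ∈-∃++ x∈xs = ys ++ zs , shift x ys zs

∷-↭-∷⁻ : ∀ {E : Set} {x y : E} {xs ys} → x ∷ xs ↭ y ∷ ys →
  (x ≡ y × xs ↭ ys) ⊎ ∃ λ zs → xs ↭ y ∷ zs × ys ↭ x ∷ zs
∷-↭-∷⁻ {x = x} {y} p with ∈-resp-↭ p (here refl)
... | here refl = inj₁ (refl , drop-∷ p)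
... | there x∈ys with zs , ys↭ ← ∈⇒↭∷ x∈ys =
  inj₂ (zs , drop-∷ (↭-trans p (↭-trans (↭-prep y ys↭) (↭-swap y x ↭-refl))) , ys↭)

↭∷-++ˡ : ∀ {E : Set} (xs : List E) {ys z zs} → ys ↭ z ∷ zs → xs ++ ys ↭ z ∷ xs ++ zs
↭∷-++ˡ xs {z = z} {zs} p = ↭-trans (++⁺ˡ xs p) (shift z xs zs)

Pointwise-++⁻ : ∀ {E F : Set} {R : E → F → Set} G {H T} → Pointwise R (G ++ H) T →
  ∃ λ Gᵀ → ∃ λ Hᵀ → T ≡ Gᵀ ++ Hᵀ × Pointwise R G Gᵀ × Pointwise R H Hᵀ
Pointwise-++⁻ []      rs       = [] , _ , refl , [] , rs
Pointwise-++⁻ (_ ∷ G) (r ∷ rs) with Gᵀ , Hᵀ , refl , rG , rH ← Pointwise-++⁻ G rs =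
  _ ∷ Gᵀ , Hᵀ , refl , r ∷ rG , rH

renT : ∀ {n} → (Param → Param) → Term n → Term n
renT ρ (var i) = var i
renT ρ (par a) = par (ρ a)

renF : ∀ {n} → (Param → Param) → Formula n → Formula n
renF ρ (atom p ts) = atom p (map (renT ρ) ts)
renF ρ ⊥ᶠ          = ⊥ᶠ
renF ρ (C ∧ᶠ D)    = renF ρ C ∧ᶠ renF ρ D
renF ρ (C ∨ᶠ D)    = renF ρ C ∨ᶠ renF ρ D
renF ρ (C ⊃ D)     = renF ρ C ⊃ renF ρ D
renF ρ (∀ᶠ C)      = ∀ᶠ (renF ρ C)
renF ρ (∃ᶠ C)      = ∃ᶠ (renF ρ C)

renL : (Param → Param) → List Fm → List Fm
renL ρ = map (renF ρ)

substT-cong : ∀ {m n} {σ τ : Fin m → Term n} → σ ≗ τ → substT σ ≗ substT τ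
substT-cong σ≗τ (var i) = σ≗τ i
substT-cong σ≗τ (par a) = refl

liftσ-cong : ∀ {m n} {σ τ : Fin m → Term n} → σ ≗ τ → liftσ σ ≗ liftσ τ
liftσ-cong σ≗τ zero    = refl
liftσ-cong σ≗τ (suc i) = cong wkT (σ≗τ i)

substF-cong : ∀ {m n} {σ τ : Fin m → Term n} → σ ≗ τ → substF σ ≗ substF τ
substF-cong σ≗τ (atom p ts) = cong (atom p) (map-cong (substT-cong σ≗τ) ts)
substF-cong σ≗τ ⊥ᶠ          = refl
substF-cong σ≗τ (C ∧ᶠ D)    = cong₂ _∧ᶠ_ (substF-cong σ≗τ C) (substF-cong σ≗τ D)
substF-cong σ≗τ (C ∨ᶠ D)    = cong₂ _∨ᶠ_ (substF-cong σ≗τ C) (substF-cong σ≗τ D)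
substF-cong σ≗τ (C ⊃ D)     = cong₂ _⊃_ (substF-cong σ≗τ C) (substF-cong σ≗τ D)
substF-cong σ≗τ (∀ᶠ C)      = cong ∀ᶠ (substF-cong (liftσ-cong σ≗τ) C)
substF-cong σ≗τ (∃ᶠ C)      = cong ∃ᶠ (substF-cong (liftσ-cong σ≗τ) C)

module _ (ρ : Param → Param) where

  renT-substT : ∀ {m n} (σ : Fin m → Term n) t →
    renT ρ (substT σ t) ≡ substT (renT ρ ∘ σ) (renT ρ t)
  renT-substT σ (var i) = refl
  renT-substT σ (par a) = refl

  renT-wkT : ∀ {n} (t : Term n) → renT ρ (wkT t) ≡ wkT (renT ρ t)
  renT-wkT (var i) = refl
  renT-wkT (par a) = refl

  renT-liftσ : ∀ {m n} (σ : Fin m → Term n) i →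
    renT ρ (liftσ σ i) ≡ liftσ (renT ρ ∘ σ) i
  renT-liftσ σ zero    = refl
  renT-liftσ σ (suc i) = renT-wkT (σ i)

  renF-substF : ∀ {m n} (σ : Fin m → Term n) F →
    renF ρ (substF σ F) ≡ substF (renT ρ ∘ σ) (renF ρ F)
  renF-substF σ (atom p ts) = cong (atom p)
    (trans (sym (map-∘ ts)) (trans (map-cong (renT-substT σ) ts) (map-∘ ts)))
  renF-substF σ ⊥ᶠ          = refl
  renF-substF σ (C ∧ᶠ D)    = cong₂ _∧ᶠ_ (renF-substF σ C) (renF-substF σ D)
  renF-substF σ (C ∨ᶠ D)    = cong₂ _∨ᶠ_ (renF-substF σ C) (renF-substF σ D)
  renF-substF σ (C ⊃ D)     = cong₂ _⊃_ (renF-substF σ C) (renF-substF σ D)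
  renF-substF σ (∀ᶠ C)      = cong ∀ᶠ
    (trans (renF-substF (liftσ σ) C) (substF-cong (renT-liftσ σ) (renF ρ C)))
  renF-substF σ (∃ᶠ C)      = cong ∃ᶠ
    (trans (renF-substF (liftσ σ) C) (substF-cong (renT-liftσ σ) (renF ρ C)))

  renF-[/x] : ∀ {n} (C : Formula (suc n)) b → renF ρ (C [ b /x]) ≡ renF ρ C [ ρ b /x]
  renF-[/x] C b = trans (renF-substF (instσ b) C) (substF-cong renT-instσ (renF ρ C))
    where
    renT-instσ : ∀ i → renT ρ (instσ b i) ≡ instσ (ρ b) i
    renT-instσ zero    = refl
    renT-instσ (suc i) = refl

  occT-renT : ∀ {n c} (t : Term n) → occT c t → occT (ρ c) (renT ρ t)
  occT-renT (par a) refl = refl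

  occF-renF : ∀ {n c} (F : Formula n) → occF c F → occF (ρ c) (renF ρ F)
  occF-renF (atom p ts) o        = Any.map⁺ (Any.map (λ {t} → occT-renT t) o)
  occF-renF (C ∧ᶠ D)    (inj₁ o) = inj₁ (occF-renF C o)
  occF-renF (C ∧ᶠ D)    (inj₂ o) = inj₂ (occF-renF D o)
  occF-renF (C ∨ᶠ D)    (inj₁ o) = inj₁ (occF-renF C o)
  occF-renF (C ∨ᶠ D)    (inj₂ o) = inj₂ (occF-renF D o)
  occF-renF (C ⊃ D)     (inj₁ o) = inj₁ (occF-renF C o)
  occF-renF (C ⊃ D)     (inj₂ o) = inj₂ (occF-renF D o)
  occF-renF (∀ᶠ C)      o        = occF-renF C o
  occF-renF (∃ᶠ C)      o        = occF-renF C o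

  occL-renL : ∀ {c} (Γ : List Fm) → Any (occF c) Γ → Any (occF (ρ c)) (renL ρ Γ)
  occL-renL Γ o = Any.map⁺ (Any.map (λ {F} → occF-renF F) o)

  renT-fix : ∀ {n} (t : Term n) → (∀ {c} → occT c t → ρ c ≡ c) → renT ρ t ≡ t
  renT-fix (var i) fix = refl
  renT-fix (par a) fix = cong par (fix refl)

  renF-fix : ∀ {n} (F : Formula n) → (∀ {c} → occF c F → ρ c ≡ c) → renF ρ F ≡ F
  renF-fix (atom p ts) fix = cong (atom p)
    (map-id-local (All.tabulate λ t∈ts → renT-fix _ λ o → fix (lose t∈ts o)))
  renF-fix ⊥ᶠ       fix = refl
  renF-fix (C ∧ᶠ D) fix = cong₂ _∧ᶠ_ (renF-fix C (fix ∘ inj₁)) (renF-fix D (fix ∘ inj₂))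
  renF-fix (C ∨ᶠ D) fix = cong₂ _∨ᶠ_ (renF-fix C (fix ∘ inj₁)) (renF-fix D (fix ∘ inj₂))
  renF-fix (C ⊃ D)  fix = cong₂ _⊃_ (renF-fix C (fix ∘ inj₁)) (renF-fix D (fix ∘ inj₂))
  renF-fix (∀ᶠ C)   fix = cong ∀ᶠ (renF-fix C fix)
  renF-fix (∃ᶠ C)   fix = cong ∃ᶠ (renF-fix C fix)

  renL-fix : ∀ (Γ : List Fm) → (∀ {c} → Any (occF c) Γ → ρ c ≡ c) → renL ρ Γ ≡ Γ
  renL-fix Γ fix = map-id-local (All.tabulate λ F∈Γ → renF-fix _ λ o → fix (lose F∈Γ o))

renL-id : ∀ Γ → renL id Γ ≡ Γ
renL-id Γ = renL-fix id Γ λ _ → refl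

transpose : Param → Param → Param → Param
transpose a b c with c ≟ a | c ≟ b
... | yes _ | _     = b
... | no _  | yes _ = a
... | no _  | no _  = c

transpose-fix : ∀ a b c → c ≢ a → c ≢ b → transpose a b c ≡ c
transpose-fix a b c c≢a c≢b with c ≟ a | c ≟ b
... | yes c≡a | _       = ⊥-elim (c≢a c≡a)
... | no _    | yes c≡b = ⊥-elim (c≢b c≡b)
... | no _    | no _    = refl

transpose-ˡ : ∀ a b → transpose a b a ≡ b
transpose-ˡ a b with a ≟ a
... | yes _   = refl
... | no a≢a = ⊥-elim (a≢a refl)

transpose-ʳ : ∀ a b → transpose a b b ≡ a
transpose-ʳ a b with b ≟ a | b ≟ b
... | yes b≡a | _       = b≡a
... | no _    | yes _   = refl
... | no _    | no b≢b = ⊥-elim (b≢b refl)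

transpose-involutive : ∀ a b c → transpose a b (transpose a b c) ≡ c
transpose-involutive a b c with c ≟ a | c ≟ b
... | yes refl | _        = transpose-ʳ c b
... | no _     | yes refl = transpose-ˡ a c
... | no c≢a   | no c≢b   = transpose-fix a b c c≢a c≢b

maxBy : ∀ {E : Set} → (E → ℕ) → List E → ℕ
maxBy f []       = 0
maxBy f (x ∷ xs) = f x ⊔ maxBy f xs

Any⇒≤maxBy : ∀ {E : Set} {P : E → Set} {a} (f : E → ℕ) →
  (∀ {x} → P x → a ≤ f x) → ∀ {xs} → Any P xs → a ≤ maxBy f xs
Any⇒≤maxBy f bound (here p)  = m≤n⇒m≤n⊔o _ (bound p)
Any⇒≤maxBy f bound (there p) = m≤n⇒m≤o⊔n _ (Any⇒≤maxBy f bound p)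

maxParamT : ∀ {n} → Term n → ℕ
maxParamT (var i) = 0
maxParamT (par a) = a

maxParamF : ∀ {n} → Formula n → ℕ
maxParamF (atom p ts) = maxBy maxParamT ts
maxParamF ⊥ᶠ          = 0
maxParamF (C ∧ᶠ D)    = maxParamF C ⊔ maxParamF D
maxParamF (C ∨ᶠ D)    = maxParamF C ⊔ maxParamF D
maxParamF (C ⊃ D)     = maxParamF C ⊔ maxParamF D
maxParamF (∀ᶠ C)      = maxParamF C
maxParamF (∃ᶠ C)      = maxParamF C

maxParamC : Comp → ℕ
maxParamC (Γ , Δ) = maxBy maxParamF Γ ⊔ maxBy maxParamF Δ

occT⇒≤maxParamT : ∀ {n a} (t : Term n) → occT a t → a ≤ maxParamT t
occT⇒≤maxParamT (par b) refl = ≤-refl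

occF⇒≤maxParamF : ∀ {n a} (F : Formula n) → occF a F → a ≤ maxParamF F
occF⇒≤maxParamF (atom p ts) o = Any⇒≤maxBy maxParamT (λ {t} → occT⇒≤maxParamT t) o
occF⇒≤maxParamF (C ∧ᶠ D) (inj₁ o) = m≤n⇒m≤n⊔o _ (occF⇒≤maxParamF C o)
occF⇒≤maxParamF (C ∧ᶠ D) (inj₂ o) = m≤n⇒m≤o⊔n _ (occF⇒≤maxParamF D o)
occF⇒≤maxParamF (C ∨ᶠ D) (inj₁ o) = m≤n⇒m≤n⊔o _ (occF⇒≤maxParamF C o)
occF⇒≤maxParamF (C ∨ᶠ D) (inj₂ o) = m≤n⇒m≤o⊔n _ (occF⇒≤maxParamF D o)
occF⇒≤maxParamF (C ⊃ D)  (inj₁ o) = m≤n⇒m≤n⊔o _ (occF⇒≤maxParamF C o)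
occF⇒≤maxParamF (C ⊃ D)  (inj₂ o) = m≤n⇒m≤o⊔n _ (occF⇒≤maxParamF D o)
occF⇒≤maxParamF (∀ᶠ C)   o        = occF⇒≤maxParamF C o
occF⇒≤maxParamF (∃ᶠ C)   o        = occF⇒≤maxParamF C o

occL⇒≤maxParamL : ∀ {a Γ} → Any (occF a) Γ → a ≤ maxBy maxParamF Γ
occL⇒≤maxParamL = Any⇒≤maxBy maxParamF (λ {F} → occF⇒≤maxParamF {0} F)

occC⇒≤maxParamC : ∀ {a} (c : Comp) → occC a c → a ≤ maxParamC c
occC⇒≤maxParamC (Γ , Δ) (inj₁ o) = m≤n⇒m≤n⊔o _ (occL⇒≤maxParamL o)
occC⇒≤maxParamC (Γ , Δ) (inj₂ o) = m≤n⇒m≤o⊔n _ (occL⇒≤maxParamL o)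

fresh : (S : LNS) → ∃ λ b → Fresh b S
fresh S = suc m , λ o → n≮n m (Any⇒≤maxBy maxParamC (λ {c} → occC⇒≤maxParamC c) o)
  where m = maxBy maxParamC S

-- A premise for every fresh parameter survives any transformation of the conclusion
-- that introduces no new parameters, so the inversion needs no renaming.
data LNIF∀ : LNS → Set where
  id₁ : ∀ {G H Γ Δ p ts} → atom p ts ∈ Γ → atom p ts ∈ Δ →
        LNIF∀ (G ++ (Γ , Δ) ∷ H)
  id₂ : ∀ {G H F Γ₁ Δ₁ Γ₂ Δ₂ p ts} → atom p ts ∈ Γ₁ → atom p ts ∈ Δ₂ →
        LNIF∀ (G ++ (Γ₁ , Δ₁) ∷ H ++ (Γ₂ , Δ₂) ∷ F)
  ⊥ₗ  : ∀ {G H Γ Δ} → ⊥ᶠ ∈ Γ → LNIF∀ (G ++ (Γ , Δ) ∷ H)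
  ∧ₗ  : ∀ {G H Γ Γ' Δ A B} → Γ ↭ (A ∧ᶠ B) ∷ Γ' →
        LNIF∀ (G ++ (A ∷ B ∷ Γ' , Δ) ∷ H) →
        LNIF∀ (G ++ (Γ , Δ) ∷ H)
  ∨ᵣ  : ∀ {G H Γ Δ Δ' A B} → Δ ↭ (A ∨ᶠ B) ∷ Δ' →
        LNIF∀ (G ++ (Γ , A ∷ B ∷ Δ') ∷ H) →
        LNIF∀ (G ++ (Γ , Δ) ∷ H)
  ∧ᵣ  : ∀ {G H Γ Δ Δ' A B} → Δ ↭ (A ∧ᶠ B) ∷ Δ' →
        LNIF∀ (G ++ (Γ , A ∷ Δ') ∷ H) →
        LNIF∀ (G ++ (Γ , B ∷ Δ') ∷ H) →
        LNIF∀ (G ++ (Γ , Δ) ∷ H)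
  ∨ₗ  : ∀ {G H Γ Γ' Δ A B} → Γ ↭ (A ∨ᶠ B) ∷ Γ' →
        LNIF∀ (G ++ (A ∷ Γ' , Δ) ∷ H) →
        LNIF∀ (G ++ (B ∷ Γ' , Δ) ∷ H) →
        LNIF∀ (G ++ (Γ , Δ) ∷ H)
  ⊃ᵣ₁ : ∀ {G Γ Δ Δ' A B} → Δ ↭ (A ⊃ B) ∷ Δ' →
        LNIF∀ (G ++ (Γ , Δ') ∷ (A ∷ [] , B ∷ []) ∷ []) →
        LNIF∀ (G ++ (Γ , Δ) ∷ [])
  ⊃ₗ  : ∀ {G H Γ Γ' Δ A B} → Γ ↭ (A ⊃ B) ∷ Γ' →
        LNIF∀ (G ++ (B ∷ Γ' , Δ) ∷ H) →
        LNIF∀ (G ++ ((A ⊃ B) ∷ Γ' , A ∷ Δ) ∷ H) →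
        LNIF∀ (G ++ (Γ , Δ) ∷ H)
  lift : ∀ {G H Γ₁ Δ₁ Γ₂ Δ₂ A} → A ∈ Γ₁ →
        LNIF∀ (G ++ (Γ₁ , Δ₁) ∷ (A ∷ Γ₂ , Δ₂) ∷ H) →
        LNIF∀ (G ++ (Γ₁ , Δ₁) ∷ (Γ₂ , Δ₂) ∷ H)
  ∀ₗ  : ∀ {G H Γ Γ' Δ A} (a : Param) → Γ ↭ ∀ᶠ A ∷ Γ' →
        LNIF∀ (G ++ (A [ a /x] ∷ ∀ᶠ A ∷ Γ' , Δ) ∷ H) →
        LNIF∀ (G ++ (Γ , Δ) ∷ H)
  ∀ᵣ₁ : ∀ {G Γ Δ Δ' A} → Δ ↭ ∀ᶠ A ∷ Δ' →
        (∀ a → Fresh a (G ++ (Γ , Δ) ∷ []) →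
          LNIF∀ (G ++ (Γ , Δ') ∷ ([] , A [ a /x] ∷ []) ∷ [])) →
        LNIF∀ (G ++ (Γ , Δ) ∷ [])
  ∃ₗ  : ∀ {G H Γ Γ' Δ A} → Γ ↭ ∃ᶠ A ∷ Γ' →
        (∀ a → Fresh a (G ++ (Γ , Δ) ∷ H) →
          LNIF∀ (G ++ (A [ a /x] ∷ Γ' , Δ) ∷ H)) →
        LNIF∀ (G ++ (Γ , Δ) ∷ H)
  ∃ᵣ  : ∀ {G H Γ Δ Δ' A} (a : Param) → Δ ↭ ∃ᶠ A ∷ Δ' →
        LNIF∀ (G ++ (Γ , A [ a /x] ∷ ∃ᶠ A ∷ Δ') ∷ H) →
        LNIF∀ (G ++ (Γ , Δ) ∷ H)
  ⊃ᵣ₂ : ∀ {G H Γ₁ Δ₁ Δ₁' Γ₂ Δ₂ A B} → Δ₁ ↭ (A ⊃ B) ∷ Δ₁' →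
        LNIF∀ (G ++ (Γ₁ , Δ₁') ∷ (A ∷ [] , B ∷ []) ∷ (Γ₂ , Δ₂) ∷ H) →
        LNIF∀ (G ++ (Γ₁ , Δ₁') ∷ (Γ₂ , (A ⊃ B) ∷ Δ₂) ∷ H) →
        LNIF∀ (G ++ (Γ₁ , Δ₁) ∷ (Γ₂ , Δ₂) ∷ H)
  ∀ᵣ₂ : ∀ {G H Γ₁ Δ₁ Δ₁' Γ₂ Δ₂ A} → Δ₁ ↭ ∀ᶠ A ∷ Δ₁' →
        (∀ a → Fresh a (G ++ (Γ₁ , Δ₁) ∷ (Γ₂ , Δ₂) ∷ H) →
          LNIF∀ (G ++ (Γ₁ , Δ₁') ∷ ([] , A [ a /x] ∷ []) ∷ (Γ₂ , Δ₂) ∷ H)) →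
        LNIF∀ (G ++ (Γ₁ , Δ₁') ∷ (Γ₂ , ∀ᶠ A ∷ Δ₂) ∷ H) →
        LNIF∀ (G ++ (Γ₁ , Δ₁) ∷ (Γ₂ , Δ₂) ∷ H)

LNIF∀⇒LNIF : ∀ {S} → LNIF∀ S → LNIF S
LNIF∀⇒LNIF (id₁ i j)   = id₁ i j
LNIF∀⇒LNIF (id₂ i j)   = id₂ i j
LNIF∀⇒LNIF (⊥ₗ i)      = ⊥ₗ i
LNIF∀⇒LNIF (∧ₗ p d)    = ∧ₗ p (LNIF∀⇒LNIF d)
LNIF∀⇒LNIF (∨ᵣ p d)    = ∨ᵣ p (LNIF∀⇒LNIF d)
LNIF∀⇒LNIF (∧ᵣ p d e)  = ∧ᵣ p (LNIF∀⇒LNIF d) (LNIF∀⇒LNIF e)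
LNIF∀⇒LNIF (∨ₗ p d e)  = ∨ₗ p (LNIF∀⇒LNIF d) (LNIF∀⇒LNIF e)
LNIF∀⇒LNIF (⊃ᵣ₁ p d)   = ⊃ᵣ₁ p (LNIF∀⇒LNIF d)
LNIF∀⇒LNIF (⊃ₗ p d e)  = ⊃ₗ p (LNIF∀⇒LNIF d) (LNIF∀⇒LNIF e)
LNIF∀⇒LNIF (lift i d)  = lift i (LNIF∀⇒LNIF d)
LNIF∀⇒LNIF (∀ₗ a p d)  = ∀ₗ a p (LNIF∀⇒LNIF d)
LNIF∀⇒LNIF (∃ᵣ a p d)  = ∃ᵣ a p (LNIF∀⇒LNIF d)
LNIF∀⇒LNIF (⊃ᵣ₂ p d e) = ⊃ᵣ₂ p (LNIF∀⇒LNIF d) (LNIF∀⇒LNIF e)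
LNIF∀⇒LNIF (∀ᵣ₁ {G} {Γ} {Δ} p f) with b , b-fresh ← fresh (G ++ (Γ , Δ) ∷ []) =
  ∀ᵣ₁ b p b-fresh (LNIF∀⇒LNIF (f b b-fresh))
LNIF∀⇒LNIF (∃ₗ {G} {H} {Γ} {Δ = Δ} p f) with b , b-fresh ← fresh (G ++ (Γ , Δ) ∷ H) =
  ∃ₗ b p b-fresh (LNIF∀⇒LNIF (f b b-fresh))
LNIF∀⇒LNIF (∀ᵣ₂ {G} {H} {Γ₁} {Δ₁} {Γ₂ = Γ₂} {Δ₂} p f e)
  with b , b-fresh ← fresh (G ++ (Γ₁ , Δ₁) ∷ (Γ₂ , Δ₂) ∷ H) =
  ∀ᵣ₂ b p b-fresh (LNIF∀⇒LNIF (f b b-fresh)) (LNIF∀⇒LNIF e)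

module Renaming (ρ : Param → Param) (ρ-involutive : ∀ c → ρ (ρ c) ≡ c) where

  _⊑_ : Comp → Comp → Set
  c ⊑ d = ∃ λ Σ₁ → ∃ λ Π₁ →
    (proj₁ d ↭ renL ρ (proj₁ c) ++ Σ₁) × (proj₂ d ↭ renL ρ (proj₂ c) ++ Π₁)

  occS-⊑ : ∀ {S T c} → Pointwise _⊑_ S T → occS c S → occS (ρ c) T
  occS-⊑ ((_ , _ , eΓ , _) ∷ _) (here (inj₁ o)) =
    here (inj₁ (Any-resp-↭ (↭-sym eΓ) (Any.++⁺ˡ (occL-renL ρ _ o))))
  occS-⊑ ((_ , _ , _ , eΔ) ∷ _) (here (inj₂ o)) =
    here (inj₂ (Any-resp-↭ (↭-sym eΔ) (Any.++⁺ˡ (occL-renL ρ _ o))))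
  occS-⊑ (_ ∷ rs) (there o) = there (occS-⊑ rs o)

  Fresh-⊑ : ∀ {S T b} → Pointwise _⊑_ S T → Fresh b T → Fresh (ρ b) S
  Fresh-⊑ {T = T} {b} rs b-fresh o =
    b-fresh (subst (λ c → occS c T) (ρ-involutive b) (occS-⊑ rs o))

  ∈ᴸ-⊑ : ∀ {c d F} → c ⊑ d → F ∈ proj₁ c → renF ρ F ∈ proj₁ d
  ∈ᴸ-⊑ (_ , _ , eΓ , _) i = ∈-resp-↭ (↭-sym eΓ) (Any.++⁺ˡ (∈-map⁺ (renF ρ) i))

  ∈ᴿ-⊑ : ∀ {c d F} → c ⊑ d → F ∈ proj₂ c → renF ρ F ∈ proj₂ d
  ∈ᴿ-⊑ (_ , _ , _ , eΔ) i = ∈-resp-↭ (↭-sym eΔ) (Any.++⁺ˡ (∈-map⁺ (renF ρ) i))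

  principal-⊑ : ∀ {Γᵀ Γ F Γ' Σ₁} → Γᵀ ↭ renL ρ Γ ++ Σ₁ → Γ ↭ F ∷ Γ' →
    Γᵀ ↭ renF ρ F ∷ (renL ρ Γ' ++ Σ₁)
  principal-⊑ {Σ₁ = Σ₁} e p = ↭-trans e (++⁺ʳ Σ₁ (map⁺ (renF ρ) p))

  renF-[/x]-∷ : ∀ (C : Formula 1) a {xs} → renF ρ C [ ρ a /x] ∷ xs ↭ renF ρ (C [ a /x]) ∷ xs
  renF-[/x]-∷ C a = ↭-reflexive (cong (_∷ _) (sym (renF-[/x] ρ C a)))

  renF-[ρ/x]-∷ : ∀ (C : Formula 1) b {xs} → renF ρ C [ b /x] ∷ xs ↭ renF ρ (C [ ρ b /x]) ∷ xs
  renF-[ρ/x]-∷ C b {xs} =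
    subst (λ c → renF ρ C [ c /x] ∷ xs ↭ renF ρ (C [ ρ b /x]) ∷ xs) (ρ-involutive b)
          (renF-[/x]-∷ C (ρ b))

  rename-weaken : ∀ {S T} → Pointwise _⊑_ S T → LNIF∀ S → LNIF∀ T
  rename-weaken rs (id₁ {G} i j) with Gᵀ , _ , refl , _ , w ∷ _ ← Pointwise-++⁻ G rs =
    id₁ {G = Gᵀ} (∈ᴸ-⊑ w i) (∈ᴿ-⊑ w j)
  rename-weaken rs (id₂ {G} {H} i j)
    with Gᵀ , _ , refl , _ , w₁ ∷ rs₁ ← Pointwise-++⁻ G rs
    with Hᵀ , _ , refl , _ , w₂ ∷ _ ← Pointwise-++⁻ H rs₁ =
    id₂ {G = Gᵀ} {H = Hᵀ} (∈ᴸ-⊑ w₁ i) (∈ᴿ-⊑ w₂ j)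
  rename-weaken rs (⊥ₗ {G} i) with Gᵀ , _ , refl , _ , w ∷ _ ← Pointwise-++⁻ G rs =
    ⊥ₗ {G = Gᵀ} (∈ᴸ-⊑ w i)
  rename-weaken rs (∧ₗ {G} p d)
    with Gᵀ , _ , refl , rG , (Σ₁ , Π₁ , eΓ , eΔ) ∷ rH ← Pointwise-++⁻ G rs =
    ∧ₗ {G = Gᵀ} (principal-⊑ eΓ p)
      (rename-weaken (Pointwise.++⁺ rG ((Σ₁ , Π₁ , ↭-refl , eΔ) ∷ rH)) d)
  rename-weaken rs (∨ᵣ {G} p d)
    with Gᵀ , _ , refl , rG , (Σ₁ , Π₁ , eΓ , eΔ) ∷ rH ← Pointwise-++⁻ G rs =
    ∨ᵣ {G = Gᵀ} (principal-⊑ eΔ p)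
      (rename-weaken (Pointwise.++⁺ rG ((Σ₁ , Π₁ , eΓ , ↭-refl) ∷ rH)) d)
  rename-weaken rs (∧ᵣ {G} p d e)
    with Gᵀ , _ , refl , rG , (Σ₁ , Π₁ , eΓ , eΔ) ∷ rH ← Pointwise-++⁻ G rs =
    ∧ᵣ {G = Gᵀ} (principal-⊑ eΔ p)
      (rename-weaken (Pointwise.++⁺ rG ((Σ₁ , Π₁ , eΓ , ↭-refl) ∷ rH)) d)
      (rename-weaken (Pointwise.++⁺ rG ((Σ₁ , Π₁ , eΓ , ↭-refl) ∷ rH)) e)
  rename-weaken rs (∨ₗ {G} p d e)
    with Gᵀ , _ , refl , rG , (Σ₁ , Π₁ , eΓ , eΔ) ∷ rH ← Pointwise-++⁻ G rs =
    ∨ₗ {G = Gᵀ} (principal-⊑ eΓ p)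
      (rename-weaken (Pointwise.++⁺ rG ((Σ₁ , Π₁ , ↭-refl , eΔ) ∷ rH)) d)
      (rename-weaken (Pointwise.++⁺ rG ((Σ₁ , Π₁ , ↭-refl , eΔ) ∷ rH)) e)
  rename-weaken rs (⊃ᵣ₁ {G} p d)
    with Gᵀ , _ , refl , rG , (Σ₁ , Π₁ , eΓ , eΔ) ∷ [] ← Pointwise-++⁻ G rs =
    ⊃ᵣ₁ {G = Gᵀ} (principal-⊑ eΔ p)
      (rename-weaken (Pointwise.++⁺ rG ((Σ₁ , Π₁ , eΓ , ↭-refl)
                                      ∷ ([] , [] , ↭-refl , ↭-refl) ∷ [])) d)
  rename-weaken rs (⊃ₗ {G} p d e)
    with Gᵀ , _ , refl , rG , (Σ₁ , Π₁ , eΓ , eΔ) ∷ rH ← Pointwise-++⁻ G rs =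
    ⊃ₗ {G = Gᵀ} (principal-⊑ eΓ p)
      (rename-weaken (Pointwise.++⁺ rG ((Σ₁ , Π₁ , ↭-refl , eΔ) ∷ rH)) d)
      (rename-weaken (Pointwise.++⁺ rG ((Σ₁ , Π₁ , ↭-refl , ↭-prep _ eΔ) ∷ rH)) e)
  rename-weaken rs (lift {G} i d)
    with Gᵀ , _ , refl , rG , w ∷ (Σ₂ , Π₂ , eΓ₂ , eΔ₂) ∷ rH ← Pointwise-++⁻ G rs =
    lift {G = Gᵀ} (∈ᴸ-⊑ w i)
      (rename-weaken (Pointwise.++⁺ rG (w ∷ (Σ₂ , Π₂ , ↭-prep _ eΓ₂ , eΔ₂) ∷ rH)) d)
  rename-weaken rs (∀ₗ {G} {A = C} a p d)
    with Gᵀ , _ , refl , rG , (Σ₁ , Π₁ , eΓ , eΔ) ∷ rH ← Pointwise-++⁻ G rs =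
    ∀ₗ {G = Gᵀ} (ρ a) (principal-⊑ eΓ p)
      (rename-weaken (Pointwise.++⁺ rG ((Σ₁ , Π₁ , renF-[/x]-∷ C a , eΔ) ∷ rH)) d)
  rename-weaken rs (∃ᵣ {G} {A = C} a p d)
    with Gᵀ , _ , refl , rG , (Σ₁ , Π₁ , eΓ , eΔ) ∷ rH ← Pointwise-++⁻ G rs =
    ∃ᵣ {G = Gᵀ} (ρ a) (principal-⊑ eΔ p)
      (rename-weaken (Pointwise.++⁺ rG ((Σ₁ , Π₁ , eΓ , renF-[/x]-∷ C a) ∷ rH)) d)
  rename-weaken rs (∃ₗ {G} {A = C} p f)
    with Gᵀ , _ , refl , rG , (Σ₁ , Π₁ , eΓ , eΔ) ∷ rH ← Pointwise-++⁻ G rs =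
    ∃ₗ {G = Gᵀ} (principal-⊑ eΓ p) λ b b-fresh →
      rename-weaken (Pointwise.++⁺ rG ((Σ₁ , Π₁ , renF-[ρ/x]-∷ C b , eΔ) ∷ rH))
        (f (ρ b) (Fresh-⊑ rs b-fresh))
  rename-weaken rs (∀ᵣ₁ {G} {A = C} p f)
    with Gᵀ , _ , refl , rG , (Σ₁ , Π₁ , eΓ , eΔ) ∷ [] ← Pointwise-++⁻ G rs =
    ∀ᵣ₁ {G = Gᵀ} (principal-⊑ eΔ p) λ b b-fresh →
      rename-weaken (Pointwise.++⁺ rG ((Σ₁ , Π₁ , eΓ , ↭-refl)
                                     ∷ ([] , [] , ↭-refl , renF-[ρ/x]-∷ C b) ∷ []))
        (f (ρ b) (Fresh-⊑ rs b-fresh))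
  rename-weaken rs (⊃ᵣ₂ {G} p d e)
    with Gᵀ , _ , refl , rG , (Σ₁ , Π₁ , eΓ , eΔ) ∷ w₂@(Σ₂ , Π₂ , eΓ₂ , eΔ₂) ∷ rH
         ← Pointwise-++⁻ G rs =
    ⊃ᵣ₂ {G = Gᵀ} (principal-⊑ eΔ p)
      (rename-weaken (Pointwise.++⁺ rG ((Σ₁ , Π₁ , eΓ , ↭-refl)
                                      ∷ ([] , [] , ↭-refl , ↭-refl) ∷ w₂ ∷ rH)) d)
      (rename-weaken (Pointwise.++⁺ rG ((Σ₁ , Π₁ , eΓ , ↭-refl)
                                      ∷ (Σ₂ , Π₂ , eΓ₂ , ↭-prep _ eΔ₂) ∷ rH)) e)
  rename-weaken rs (∀ᵣ₂ {G} {A = C} p f e)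
    with Gᵀ , _ , refl , rG , (Σ₁ , Π₁ , eΓ , eΔ) ∷ w₂@(Σ₂ , Π₂ , eΓ₂ , eΔ₂) ∷ rH
         ← Pointwise-++⁻ G rs =
    ∀ᵣ₂ {G = Gᵀ} (principal-⊑ eΔ p)
      (λ b b-fresh → rename-weaken (Pointwise.++⁺ rG ((Σ₁ , Π₁ , eΓ , ↭-refl)
                        ∷ ([] , [] , ↭-refl , renF-[ρ/x]-∷ C b) ∷ w₂ ∷ rH))
                       (f (ρ b) (Fresh-⊑ rs b-fresh)))
      (rename-weaken (Pointwise.++⁺ rG ((Σ₁ , Π₁ , eΓ , ↭-refl)
                                      ∷ (Σ₂ , Π₂ , eΓ₂ , ↭-prep _ eΔ₂) ∷ rH)) e)

module Transposition (a b : Param) where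

  τ : Param → Param
  τ = transpose a b

  open Renaming τ (transpose-involutive a b) public

  FixesC : Comp → Set
  FixesC c = ∀ {x} → occC x c → τ x ≡ x

  Fixes : LNS → Set
  Fixes S = ∀ {x} → occS x S → τ x ≡ x

  fixes : ∀ {S} → Fresh a S → Fresh b S → Fixes S
  fixes a-fresh b-fresh {x} o =
    transpose-fix a b x (λ { refl → a-fresh o }) (λ { refl → b-fresh o })

  renL-τ : ∀ Γ → (∀ {x} → Any (occF x) Γ → τ x ≡ x) → Γ ↭ renL τ Γ ++ []
  renL-τ Γ fix = ↭-reflexive (sym (trans (++-identityʳ _) (renL-fix τ Γ fix)))

  ⊑-refl : ∀ {c} → FixesC c → c ⊑ c
  ⊑-refl {Γ , Δ} fix = [] , [] , renL-τ Γ (fix ∘ inj₁) , renL-τ Δ (fix ∘ inj₂)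

  Pointwise-⊑-refl : ∀ S → Fixes S → Pointwise _⊑_ S S
  Pointwise-⊑-refl []      fix = []
  Pointwise-⊑-refl (c ∷ S) fix = ⊑-refl (fix ∘ here) ∷ Pointwise-⊑-refl S (fix ∘ there)

  renF-τ-[a/x] : ∀ (C : Formula 1) → (∀ {x} → occF x C → τ x ≡ x) → renF τ (C [ a /x]) ≡ C [ b /x]
  renF-τ-[a/x] C fix =
    trans (renF-[/x] τ C a) (cong₂ (λ D c → D [ c /x]) (renF-fix τ C fix) (transpose-ˡ a b))

  module _ (G : LNS) {c H} (fix : Fixes (G ++ c ∷ H)) where

    fixes-prefix : Fixes G
    fixes-prefix = fix ∘ Any.++⁺ˡ

    fixes-focus : FixesC c
    fixes-focus = fix ∘ Any.++⁺ʳ G ∘ here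

    fixes-suffix : Fixes H
    fixes-suffix = fix ∘ Any.++⁺ʳ G ∘ there

  module _ {Γ Δ F Γ'} (p : Γ ↭ F ∷ Γ') (fix : FixesC (Γ , Δ)) where

    fixes-principalᴸ : ∀ {x} → occF x F → τ x ≡ x
    fixes-principalᴸ = fix ∘ inj₁ ∘ Any-resp-↭ (↭-sym p) ∘ here

    fixes-sideᴸ : FixesC (Γ' , Δ)
    fixes-sideᴸ (inj₁ o) = fix (inj₁ (Any-resp-↭ (↭-sym p) (there o)))
    fixes-sideᴸ (inj₂ o) = fix (inj₂ o)

  module _ {Γ Δ F Δ'} (p : Δ ↭ F ∷ Δ') (fix : FixesC (Γ , Δ)) where

    fixes-principalᴿ : ∀ {x} → occF x F → τ x ≡ x
    fixes-principalᴿ = fix ∘ inj₂ ∘ Any-resp-↭ (↭-sym p) ∘ here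

    fixes-sideᴿ : FixesC (Γ , Δ')
    fixes-sideᴿ (inj₁ o) = fix (inj₁ o)
    fixes-sideᴿ (inj₂ o) = fix (inj₂ (Any-resp-↭ (↭-sym p) (there o)))

  ⊑-∷ᴸ : ∀ {F F' Γ Δ} → renF τ F ≡ F' → FixesC (Γ , Δ) → (F ∷ Γ , Δ) ⊑ (F' ∷ Γ , Δ)
  ⊑-∷ᴸ refl fix with Σ₁ , Π₁ , eΓ , eΔ ← ⊑-refl fix = Σ₁ , Π₁ , ↭-prep _ eΓ , eΔ

  ⊑-∷ᴿ : ∀ {F F' Γ Δ} → renF τ F ≡ F' → FixesC (Γ , Δ) → (Γ , F ∷ Δ) ⊑ (Γ , F' ∷ Δ)
  ⊑-∷ᴿ refl fix with Σ₁ , Π₁ , eΓ , eΔ ← ⊑-refl fix = Σ₁ , Π₁ , eΓ , ↭-prep _ eΔ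

  ∃ₗ-premises : ∀ G {H Γ Γ' Δ C} → Fixes (G ++ (Γ , Δ) ∷ H) → Γ ↭ ∃ᶠ C ∷ Γ' →
    Pointwise _⊑_ (G ++ (C [ a /x] ∷ Γ' , Δ) ∷ H) (G ++ (C [ b /x] ∷ Γ' , Δ) ∷ H)
  ∃ₗ-premises G {H} {C = C} fix p =
    Pointwise.++⁺ (Pointwise-⊑-refl G (fixes-prefix G fix))
      (⊑-∷ᴸ (renF-τ-[a/x] C (fixes-principalᴸ p fc)) (fixes-sideᴸ p fc)
       ∷ Pointwise-⊑-refl H (fixes-suffix G fix))
    where fc = fixes-focus G fix

  ∀ᵣ-premises : ∀ G {H Γ Δ Δ' C} → Fixes (G ++ (Γ , Δ) ∷ H) → Δ ↭ ∀ᶠ C ∷ Δ' →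
    Pointwise _⊑_ (G ++ (Γ , Δ') ∷ ([] , C [ a /x] ∷ []) ∷ H)
                  (G ++ (Γ , Δ') ∷ ([] , C [ b /x] ∷ []) ∷ H)
  ∀ᵣ-premises G {H} {C = C} fix p =
    Pointwise.++⁺ (Pointwise-⊑-refl G (fixes-prefix G fix))
      (⊑-refl (fixes-sideᴿ p fc)
       ∷ ⊑-∷ᴿ (renF-τ-[a/x] C (fixes-principalᴿ p fc)) (λ { (inj₁ ()) ; (inj₂ ()) })
       ∷ Pointwise-⊑-refl H (fixes-suffix G fix))
    where fc = fixes-focus G fix

LNIF⇒LNIF∀ : ∀ {S} → LNIF S → LNIF∀ S
LNIF⇒LNIF∀ (id₁ i j)   = id₁ i j
LNIF⇒LNIF∀ (id₂ i j)   = id₂ i j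
LNIF⇒LNIF∀ (⊥ₗ i)      = ⊥ₗ i
LNIF⇒LNIF∀ (∧ₗ p d)    = ∧ₗ p (LNIF⇒LNIF∀ d)
LNIF⇒LNIF∀ (∨ᵣ p d)    = ∨ᵣ p (LNIF⇒LNIF∀ d)
LNIF⇒LNIF∀ (∧ᵣ p d e)  = ∧ᵣ p (LNIF⇒LNIF∀ d) (LNIF⇒LNIF∀ e)
LNIF⇒LNIF∀ (∨ₗ p d e)  = ∨ₗ p (LNIF⇒LNIF∀ d) (LNIF⇒LNIF∀ e)
LNIF⇒LNIF∀ (⊃ᵣ₁ p d)   = ⊃ᵣ₁ p (LNIF⇒LNIF∀ d)
LNIF⇒LNIF∀ (⊃ₗ p d e)  = ⊃ₗ p (LNIF⇒LNIF∀ d) (LNIF⇒LNIF∀ e)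
LNIF⇒LNIF∀ (lift i d)  = lift i (LNIF⇒LNIF∀ d)
LNIF⇒LNIF∀ (∀ₗ a p d)  = ∀ₗ a p (LNIF⇒LNIF∀ d)
LNIF⇒LNIF∀ (∃ᵣ a p d)  = ∃ᵣ a p (LNIF⇒LNIF∀ d)
LNIF⇒LNIF∀ (⊃ᵣ₂ p d e) = ⊃ᵣ₂ p (LNIF⇒LNIF∀ d) (LNIF⇒LNIF∀ e)
LNIF⇒LNIF∀ (∃ₗ {G} a p a-fresh d) = ∃ₗ p λ b b-fresh → let open Transposition a b in
  rename-weaken (∃ₗ-premises G (fixes a-fresh b-fresh) p) (LNIF⇒LNIF∀ d)
LNIF⇒LNIF∀ (∀ᵣ₁ {G} a p a-fresh d) = ∀ᵣ₁ p λ b b-fresh → let open Transposition a b in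
  rename-weaken (∀ᵣ-premises G (fixes a-fresh b-fresh) p) (LNIF⇒LNIF∀ d)
LNIF⇒LNIF∀ (∀ᵣ₂ {G} a p a-fresh d e) = ∀ᵣ₂ p (λ b b-fresh → let open Transposition a b in
  rename-weaken (∀ᵣ-premises G (fixes a-fresh b-fresh) p) (LNIF⇒LNIF∀ d)) (LNIF⇒LNIF∀ e)

open Renaming id (λ _ → refl) using () renaming (_⊑_ to _≼_; rename-weaken to weaken)

≼-intro : ∀ {Γ Δ Γ' Δ' Σ₁ Π₁} → Γ' ↭ Γ ++ Σ₁ → Δ' ↭ Δ ++ Π₁ → (Γ , Δ) ≼ (Γ' , Δ')
≼-intro {Γ} {Δ} eΓ eΔ =
  _ , _ , subst (λ Γ₀ → _ ↭ Γ₀ ++ _) (sym (renL-id Γ)) eΓ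
        , subst (λ Δ₀ → _ ↭ Δ₀ ++ _) (sym (renL-id Δ)) eΔ

≼-refl : ∀ {c} → c ≼ c
≼-refl = ≼-intro (↭-reflexive (sym (++-identityʳ _))) (↭-reflexive (sym (++-identityʳ _)))

↭⇒≼ᴿ : ∀ {Γ Δ Δ'} → Δ' ↭ Δ → (Γ , Δ') ≼ (Γ , Δ)
↭⇒≼ᴿ {Δ' = Δ'} e = ≼-intro (↭-reflexive (sym (++-identityʳ _)))
                             (↭-trans (↭-sym e) (↭-reflexive (sym (++-identityʳ Δ'))))

∈⇒≼ : ∀ {A B Γ Δ} → A ∈ Γ → B ∈ Δ → (A ∷ [] , B ∷ []) ≼ (Γ , Δ)
∈⇒≼ A∈Γ B∈Δ = ≼-intro (proj₂ (∈⇒↭∷ A∈Γ)) (proj₂ (∈⇒↭∷ B∈Δ))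

exchangeᴿ : ∀ G {Γ Δ Δ' H} → Δ' ↭ Δ → LNIF∀ (G ++ (Γ , Δ') ∷ H) → LNIF∀ (G ++ (Γ , Δ) ∷ H)
exchangeᴿ G e = weaken (Pointwise.++⁺ (Pointwise.refl ≼-refl) (↭⇒≼ᴿ e ∷ Pointwise.refl ≼-refl))

weaken-⊃ᵣ-premise : ∀ G {Γ Δ Δ' A B Γ₂ Δ₂ H} → Δ' ↭ Δ → A ∈ Γ₂ → B ∈ Δ₂ →
  LNIF∀ (G ++ (Γ , Δ') ∷ (A ∷ [] , B ∷ []) ∷ H) → LNIF∀ (G ++ (Γ , Δ) ∷ (Γ₂ , Δ₂) ∷ H)
weaken-⊃ᵣ-premise G e A∈Γ₂ B∈Δ₂ = weaken
  (Pointwise.++⁺ (Pointwise.refl ≼-refl) (↭⇒≼ᴿ e ∷ ∈⇒≼ A∈Γ₂ B∈Δ₂ ∷ Pointwise.refl ≼-refl))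

Fresh-push : ∀ G {a Γ₁ Δ₁ Δ₁' F Γ₂ Δ₂ H} → Δ₁ ↭ F ∷ Δ₁' →
  Fresh a (G ++ (Γ₁ , Δ₁') ∷ (Γ₂ , F ∷ Δ₂) ∷ H) → Fresh a (G ++ (Γ₁ , Δ₁) ∷ (Γ₂ , Δ₂) ∷ H)
Fresh-push G {a} {Γ₁} {Δ₁} {Δ₁'} {F} {Γ₂} {Δ₂} {H} e a-fresh o =
  a-fresh ([ Any.++⁺ˡ , Any.++⁺ʳ G ∘ push ]′ (Any.++⁻ G o))
  where
  push : occS a ((Γ₁ , Δ₁) ∷ (Γ₂ , Δ₂) ∷ H) → occS a ((Γ₁ , Δ₁') ∷ (Γ₂ , F ∷ Δ₂) ∷ H)
  push (here (inj₁ o)) = here (inj₁ o)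
  push (here (inj₂ o)) with Any-resp-↭ e o
  ... | here oF  = there (here (inj₂ (here oF)))
  ... | there o' = here (inj₂ o')
  push (there (here (inj₁ o))) = there (here (inj₁ o))
  push (there (here (inj₂ o))) = there (here (inj₂ (there o)))
  push (there (there o))       = there (there o)

module _ (G : LNS) (c : Comp) (S : LNS) where

  reassoc : LNIF∀ ((G ++ c ∷ []) ++ S) → LNIF∀ (G ++ c ∷ S)
  reassoc = subst LNIF∀ (++-assoc G (c ∷ []) S)

  reassoc⁻ : LNIF∀ (G ++ c ∷ S) → LNIF∀ ((G ++ c ∷ []) ++ S)
  reassoc⁻ = subst LNIF∀ (sym (++-assoc G (c ∷ []) S))

  Fresh-reassoc : ∀ {a} → Fresh a ((G ++ c ∷ []) ++ S) → Fresh a (G ++ c ∷ S)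
  Fresh-reassoc {a} = subst (Fresh a) (++-assoc G (c ∷ []) S)

lift-skip : ∀ G {Γ₁ Δ₁ Γ Δ Γ₂ Δ₂ H C} → C ∈ Γ₁ →
  LNIF∀ (G ++ (Γ₁ , Δ₁) ∷ (C ∷ Γ , Δ) ∷ (C ∷ Γ₂ , Δ₂) ∷ H) →
  LNIF∀ (G ++ (Γ₁ , Δ₁) ∷ (Γ , Δ) ∷ (Γ₂ , Δ₂) ∷ H)
lift-skip G {Γ₁} {Δ₁} i d =
  lift {G = G} i (reassoc G _ _ (lift {G = G ++ (Γ₁ , Δ₁) ∷ []} (here refl) (reassoc⁻ G _ _ d)))

⊃ᵣ₁-skip : ∀ G {Γ₁ Δ₁ Δ₁' Γ Δ C D} → Δ₁ ↭ (C ⊃ D) ∷ Δ₁' →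
  LNIF∀ (G ++ (Γ₁ , Δ₁') ∷ (C ∷ [] , D ∷ []) ∷ (Γ , Δ) ∷ []) →
  LNIF∀ (G ++ (Γ₁ , Δ₁') ∷ (Γ , Δ) ∷ (C ∷ [] , D ∷ []) ∷ []) →
  LNIF∀ (G ++ (Γ₁ , Δ₁) ∷ (Γ , Δ) ∷ [])
⊃ᵣ₁-skip G {Γ₁} {Δ₁' = Δ₁'} q d e =
  ⊃ᵣ₂ {G = G} {H = []} q d
    (reassoc G _ _ (⊃ᵣ₁ {G = G ++ (Γ₁ , Δ₁') ∷ []} ↭-refl (reassoc⁻ G _ _ e)))

⊃ᵣ₂-skip : ∀ G {Γ₁ Δ₁ Δ₁' Γ Δ Γ₂ Δ₂ H C D} → Δ₁ ↭ (C ⊃ D) ∷ Δ₁' →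
  LNIF∀ (G ++ (Γ₁ , Δ₁') ∷ (C ∷ [] , D ∷ []) ∷ (Γ , Δ) ∷ (Γ₂ , Δ₂) ∷ H) →
  LNIF∀ (G ++ (Γ₁ , Δ₁') ∷ (Γ , Δ) ∷ (C ∷ [] , D ∷ []) ∷ (Γ₂ , Δ₂) ∷ H) →
  LNIF∀ (G ++ (Γ₁ , Δ₁') ∷ (Γ , Δ) ∷ (Γ₂ , (C ⊃ D) ∷ Δ₂) ∷ H) →
  LNIF∀ (G ++ (Γ₁ , Δ₁) ∷ (Γ , Δ) ∷ (Γ₂ , Δ₂) ∷ H)
⊃ᵣ₂-skip G {Γ₁} {Δ₁' = Δ₁'} q d e₁ e₂ =
  ⊃ᵣ₂ {G = G} q d
    (reassoc G _ _
      (⊃ᵣ₂ {G = G ++ (Γ₁ , Δ₁') ∷ []} ↭-refl (reassoc⁻ G _ _ e₁) (reassoc⁻ G _ _ e₂)))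

∀ᵣ₁-skip : ∀ G {Γ₁ Δ₁ Δ₁' Γ Δ C} → Δ₁ ↭ ∀ᶠ C ∷ Δ₁' →
  (∀ a → Fresh a (G ++ (Γ₁ , Δ₁) ∷ (Γ , Δ) ∷ []) →
    LNIF∀ (G ++ (Γ₁ , Δ₁') ∷ ([] , C [ a /x] ∷ []) ∷ (Γ , Δ) ∷ [])) →
  (∀ a → Fresh a (G ++ (Γ₁ , Δ₁) ∷ (Γ , Δ) ∷ []) →
    LNIF∀ (G ++ (Γ₁ , Δ₁') ∷ (Γ , Δ) ∷ ([] , C [ a /x] ∷ []) ∷ [])) →
  LNIF∀ (G ++ (Γ₁ , Δ₁) ∷ (Γ , Δ) ∷ [])
∀ᵣ₁-skip G {Γ₁} {Δ₁' = Δ₁'} q f g =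
  ∀ᵣ₂ {G = G} {H = []} q f
    (reassoc G _ _ (∀ᵣ₁ {G = G ++ (Γ₁ , Δ₁') ∷ []} ↭-refl λ a a-fresh →
      reassoc⁻ G _ _ (g a (Fresh-push G q (Fresh-reassoc G _ _ a-fresh)))))

∀ᵣ₂-skip : ∀ G {Γ₁ Δ₁ Δ₁' Γ Δ Γ₂ Δ₂ H C} → Δ₁ ↭ ∀ᶠ C ∷ Δ₁' →
  (∀ a → Fresh a (G ++ (Γ₁ , Δ₁) ∷ (Γ , Δ) ∷ (Γ₂ , Δ₂) ∷ H) →
    LNIF∀ (G ++ (Γ₁ , Δ₁') ∷ ([] , C [ a /x] ∷ []) ∷ (Γ , Δ) ∷ (Γ₂ , Δ₂) ∷ H)) →
  (∀ a → Fresh a (G ++ (Γ₁ , Δ₁) ∷ (Γ , Δ) ∷ (Γ₂ , Δ₂) ∷ H) →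
    LNIF∀ (G ++ (Γ₁ , Δ₁') ∷ (Γ , Δ) ∷ ([] , C [ a /x] ∷ []) ∷ (Γ₂ , Δ₂) ∷ H)) →
  LNIF∀ (G ++ (Γ₁ , Δ₁') ∷ (Γ , Δ) ∷ (Γ₂ , ∀ᶠ C ∷ Δ₂) ∷ H) →
  LNIF∀ (G ++ (Γ₁ , Δ₁) ∷ (Γ , Δ) ∷ (Γ₂ , Δ₂) ∷ H)
∀ᵣ₂-skip G {Γ₁} {Δ₁' = Δ₁'} q f g e =
  ∀ᵣ₂ {G = G} q f
    (reassoc G _ _ (∀ᵣ₂ {G = G ++ (Γ₁ , Δ₁') ∷ []} ↭-refl
      (λ a a-fresh → reassoc⁻ G _ _ (g a (Fresh-push G q (Fresh-reassoc G _ _ a-fresh))))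
      (reassoc⁻ G _ _ e)))

module Inversion (A B : Fm) where

  data Stage : Set where
    seeking carrying : Stage

  -- Extract seeking S T: T is S with A ⊃ B removed from the succedent of one component
  -- and a component containing A ⊢ B inserted somewhere to its right; the stage records
  -- whether the removal (seeking) or only the insertion (carrying) is still ahead.
  data Extract : Stage → LNS → LNS → Set where
    skip  : ∀ {c S T} → Extract seeking S T → Extract seeking (c ∷ S) (c ∷ T)
    take  : ∀ {Γ Δ₀ Δ S T} → Δ₀ ↭ (A ⊃ B) ∷ Δ → Extract carrying S T →
            Extract seeking ((Γ , Δ₀) ∷ S) ((Γ , Δ) ∷ T)
    carry : ∀ {c S T} → Extract carrying S T → Extract carrying (c ∷ S) (c ∷ T)
    put   : ∀ {Γ Δ S} → A ∈ Γ → B ∈ Δ → Extract carrying S ((Γ , Δ) ∷ S)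

  skips : ∀ G {S T} → Extract seeking S T → Extract seeking (G ++ S) (G ++ T)
  skips []      r = r
  skips (c ∷ G) r = skip (skips G r)

  occ⊃-Extract : ∀ {S T x} → Extract carrying S T → occF x (A ⊃ B) → occS x T
  occ⊃-Extract (carry r) o        = there (occ⊃-Extract r o)
  occ⊃-Extract (put a b) (inj₁ o) = here (inj₁ (lose a o))
  occ⊃-Extract (put a b) (inj₂ o) = here (inj₂ (lose b o))

  occS-Extract : ∀ {s S T x} → Extract s S T → occS x S → occS x T
  occS-Extract (skip r)   (here o)         = here o
  occS-Extract (skip r)   (there o)        = there (occS-Extract r o)
  occS-Extract (take p r) (here (inj₁ o))  = here (inj₁ o)
  occS-Extract (take p r) (here (inj₂ o)) with Any-resp-↭ p o
  ... | here o⊃ = there (occ⊃-Extract r o⊃)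
  ... | there o' = here (inj₂ o')
  occS-Extract (take p r) (there o)        = there (occS-Extract r o)
  occS-Extract (carry r)  (here o)         = here o
  occS-Extract (carry r)  (there o)        = there (occS-Extract r o)
  occS-Extract (put a b)  o                = there o

  Fresh-Extract : ∀ {s S T x} → Extract s S T → Fresh x T → Fresh x S
  Fresh-Extract r x-fresh = x-fresh ∘ occS-Extract r

  data CarryPosition (G : LNS) : Comp → LNS → LNS → Set where
    ahead  : ∀ {c H Gᵀ T} →
             (∀ {S T'} → Extract carrying S T' → Extract carrying (G ++ S) (Gᵀ ++ T')) →
             Extract carrying H T → CarryPosition G c H (Gᵀ ++ c ∷ T)
    behind : ∀ {c H Gᵀ} → (∀ {S} → Extract carrying (G ++ S) (Gᵀ ++ S)) →
             CarryPosition G c H (Gᵀ ++ c ∷ H)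

  carry-position : ∀ G {c H T} → Extract carrying (G ++ c ∷ H) T → CarryPosition G c H T
  carry-position []      (carry r) = ahead id r
  carry-position []      (put a b) = behind {Gᵀ = _ ∷ []} (put a b)
  carry-position (d ∷ G) (carry r) with carry-position G r
  ... | ahead tr r' = ahead (λ r'' → carry (tr r'')) r'
  ... | behind tr   = behind (carry tr)
  carry-position (d ∷ G) (put a b) = behind {Gᵀ = _ ∷ d ∷ G} (put a b)

  -- Where the component following G lies relative to the source and the insertion point.
  data Position (G : LNS) : Comp → LNS → LNS → Set where
    before  : ∀ {c H T} → Extract seeking H T → Position G c H (G ++ c ∷ T)
    source  : ∀ {Γ Δ₀ Δ H T} → Δ₀ ↭ (A ⊃ B) ∷ Δ → Extract carrying H T →
              Position G (Γ , Δ₀) H (G ++ (Γ , Δ) ∷ T)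
    between : ∀ {c H Gᵀ T} →
              (∀ {S T'} → Extract carrying S T' → Extract seeking (G ++ S) (Gᵀ ++ T')) →
              Extract carrying H T → Position G c H (Gᵀ ++ c ∷ T)
    beyond  : ∀ {c H Gᵀ} → (∀ {S} → Extract seeking (G ++ S) (Gᵀ ++ S)) →
              Position G c H (Gᵀ ++ c ∷ H)

  position : ∀ G {c H T} → Extract seeking (G ++ c ∷ H) T → Position G c H T
  position []      (skip r)   = before r
  position []      (take p r) = source p r
  position (d ∷ G) (skip r) with position G r
  ... | before r'     = before r'
  ... | source p r'   = source p r'
  ... | between tr r' = between (λ r'' → skip (tr r'')) r'
  ... | beyond tr     = beyond (skip tr)
  position (d ∷ G) (take p r) with carry-position G r
  ... | ahead tr r' = between (λ r'' → take p (tr r'')) r'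
  ... | behind tr   = beyond (take p tr)

  data Focus (G : LNS) : Comp → LNS → LNS → Set where
    untouched : ∀ {c H} Gᵀ T → (∀ {c'} → Extract seeking (G ++ c' ∷ H) (Gᵀ ++ c' ∷ T)) →
                Focus G c H (Gᵀ ++ c ∷ T)
    touched   : ∀ {Γ Δ₀ Δ H T} → Δ₀ ↭ (A ⊃ B) ∷ Δ → Extract carrying H T →
                Focus G (Γ , Δ₀) H (G ++ (Γ , Δ) ∷ T)

  focus : ∀ G {c H T} → Extract seeking (G ++ c ∷ H) T → Focus G c H T
  focus G r with position G r
  ... | before r'     = untouched G _ (skips G (skip r'))
  ... | source p r'   = touched p r'
  ... | between tr r' = untouched _ _ (tr (carry r'))
  ... | beyond tr     = untouched _ _ tr

  atom∈-removed : ∀ {Δ₀ Δ p ts} → Δ₀ ↭ (A ⊃ B) ∷ Δ → atom p ts ∈ Δ₀ → atom p ts ∈ Δ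
  atom∈-removed e i with ∈-resp-↭ e i
  ... | there i' = i'

  data Focusᴸ (G : LNS) (Γ Δ : List Fm) (H : LNS) : LNS → Set where
    focusᴸ : ∀ Gᵀ Δᵀ T →
             (∀ {Γ' Σ} → Extract seeking (G ++ (Γ' , Σ ++ Δ) ∷ H) (Gᵀ ++ (Γ' , Σ ++ Δᵀ) ∷ T)) →
             (∀ {p ts} → atom p ts ∈ Δ → atom p ts ∈ Δᵀ) →
             Focusᴸ G Γ Δ H (Gᵀ ++ (Γ , Δᵀ) ∷ T)

  focus-left : ∀ G {Γ Δ H T} → Extract seeking (G ++ (Γ , Δ) ∷ H) T → Focusᴸ G Γ Δ H T
  focus-left G r with focus G r
  ... | untouched Gᵀ T tr = focusᴸ Gᵀ _ T tr id
  ... | touched p r'      =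
    focusᴸ G _ _ (λ {_} {Σ} → skips G (take (↭∷-++ˡ Σ p) r')) (atom∈-removed p)

  data Focusᴿ (G : LNS) (F : Fm) (Γ Δ' : List Fm) (H : LNS) : LNS → Set where
    focusᴿ : ∀ Gᵀ Δᵀ Δᵀ' T → Δᵀ ↭ F ∷ Δᵀ' →
             (∀ {Σ} → Extract seeking (G ++ (Γ , Σ ++ Δ') ∷ H) (Gᵀ ++ (Γ , Σ ++ Δᵀ') ∷ T)) →
             Focusᴿ G F Γ Δ' H (Gᵀ ++ (Γ , Δᵀ) ∷ T)

  focus-right : ∀ G {F Γ Δ Δ' H T} → F ≢ (A ⊃ B) → Δ ↭ F ∷ Δ' →
    Extract seeking (G ++ (Γ , Δ) ∷ H) T → Focusᴿ G F Γ Δ' H T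
  focus-right G F≢A⊃B q r with focus G r
  ... | untouched Gᵀ T tr = focusᴿ Gᵀ _ _ T q tr
  ... | touched p r' with ∷-↭-∷⁻ (↭-trans (↭-sym p) q)
  ...   | inj₁ (A⊃B≡F , _)     = ⊥-elim (F≢A⊃B (sym A⊃B≡F))
  ...   | inj₂ (Δ₁ , Δ↭ , Δ'↭) = focusᴿ G _ Δ₁ _ Δ↭ (λ {Σ} → skips G (take (↭∷-++ˡ Σ Δ'↭) r'))

  id₂-carrying : ∀ G H {Γ₁ Δ₁ Γ₂ Δ₂ F T p ts} → Extract carrying (H ++ (Γ₂ , Δ₂) ∷ F) T →
    atom p ts ∈ Γ₁ → atom p ts ∈ Δ₂ → LNIF∀ (G ++ (Γ₁ , Δ₁) ∷ T)
  id₂-carrying G H r i j with carry-position H r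
  ... | ahead {Gᵀ = Hᵀ} _ _ = id₂ {G = G} {H = Hᵀ} i j
  ... | behind {Gᵀ = Hᵀ} _  = id₂ {G = G} {H = Hᵀ} i j

  invert-id₂ : ∀ G H {Γ₁ Δ₁ Γ₂ Δ₂ F T p ts} →
    Extract seeking (G ++ (Γ₁ , Δ₁) ∷ H ++ (Γ₂ , Δ₂) ∷ F) T →
    atom p ts ∈ Γ₁ → atom p ts ∈ Δ₂ → LNIF∀ T
  invert-id₂ G H r i j with position G r
  ... | before r' with focus-left H r'
  ...   | focusᴸ Hᵀ _ _ _ keep = id₂ {G = G} {H = Hᵀ} i (keep j)
  invert-id₂ G H r i j | source _ r'                 = id₂-carrying G H r' i j
  invert-id₂ G H r i j | between {Gᵀ = Gᵀ} _ r'      = id₂-carrying Gᵀ H r' i j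
  invert-id₂ G H r i j | beyond {Gᵀ = Gᵀ} _          = id₂ {G = Gᵀ} {H = H} i j

  invert : ∀ {S T} → Extract seeking S T → LNIF∀ S → LNIF∀ T

  invert-lift : ∀ G {H Γ₁ Δ₁ Γ₂ Δ₂ C T} →
    Extract seeking (G ++ (Γ₁ , Δ₁) ∷ (Γ₂ , Δ₂) ∷ H) T → C ∈ Γ₁ →
    LNIF∀ (G ++ (Γ₁ , Δ₁) ∷ (C ∷ Γ₂ , Δ₂) ∷ H) → LNIF∀ T

  invert-⊃ᵣ₁ : ∀ G {Γ Δ Δ' C D T} → Extract seeking (G ++ (Γ , Δ) ∷ []) T →
    Δ ↭ (C ⊃ D) ∷ Δ' → LNIF∀ (G ++ (Γ , Δ') ∷ (C ∷ [] , D ∷ []) ∷ []) → LNIF∀ T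

  invert-∀ᵣ₁ : ∀ G {Γ Δ Δ' C T} → Extract seeking (G ++ (Γ , Δ) ∷ []) T →
    Δ ↭ ∀ᶠ C ∷ Δ' →
    (∀ a → Fresh a (G ++ (Γ , Δ) ∷ []) → LNIF∀ (G ++ (Γ , Δ') ∷ ([] , C [ a /x] ∷ []) ∷ [])) →
    LNIF∀ T

  invert-⊃ᵣ₂ : ∀ G {H Γ₁ Δ₁ Δ₁' Γ₂ Δ₂ C D T} →
    Extract seeking (G ++ (Γ₁ , Δ₁) ∷ (Γ₂ , Δ₂) ∷ H) T → Δ₁ ↭ (C ⊃ D) ∷ Δ₁' →
    LNIF∀ (G ++ (Γ₁ , Δ₁') ∷ (C ∷ [] , D ∷ []) ∷ (Γ₂ , Δ₂) ∷ H) →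
    LNIF∀ (G ++ (Γ₁ , Δ₁') ∷ (Γ₂ , (C ⊃ D) ∷ Δ₂) ∷ H) → LNIF∀ T

  invert-∀ᵣ₂ : ∀ G {H Γ₁ Δ₁ Δ₁' Γ₂ Δ₂ C T} →
    Extract seeking (G ++ (Γ₁ , Δ₁) ∷ (Γ₂ , Δ₂) ∷ H) T → Δ₁ ↭ ∀ᶠ C ∷ Δ₁' →
    (∀ a → Fresh a (G ++ (Γ₁ , Δ₁) ∷ (Γ₂ , Δ₂) ∷ H) →
      LNIF∀ (G ++ (Γ₁ , Δ₁') ∷ ([] , C [ a /x] ∷ []) ∷ (Γ₂ , Δ₂) ∷ H)) →
    LNIF∀ (G ++ (Γ₁ , Δ₁') ∷ (Γ₂ , ∀ᶠ C ∷ Δ₂) ∷ H) → LNIF∀ T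

  invert r (id₁ {G} i j) with focus-left G r
  ... | focusᴸ Gᵀ _ _ _ keep = id₁ {G = Gᵀ} i (keep j)
  invert r (id₂ {G} {H} i j) = invert-id₂ G H r i j
  invert r (⊥ₗ {G} i) with focus-left G r
  ... | focusᴸ Gᵀ _ _ _ _ = ⊥ₗ {G = Gᵀ} i
  invert r (∧ₗ {G} q d) with focus-left G r
  ... | focusᴸ Gᵀ _ _ tr _ = ∧ₗ {G = Gᵀ} q (invert (tr {Σ = []}) d)
  invert r (∨ₗ {G} q d e) with focus-left G r
  ... | focusᴸ Gᵀ _ _ tr _ = ∨ₗ {G = Gᵀ} q (invert (tr {Σ = []}) d) (invert (tr {Σ = []}) e)
  invert r (⊃ₗ {G} q d e) with focus-left G r
  ... | focusᴸ Gᵀ _ _ tr _ = ⊃ₗ {G = Gᵀ} q (invert (tr {Σ = []}) d) (invert (tr {Σ = _ ∷ []}) e)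
  invert r (∀ₗ {G} a q d) with focus-left G r
  ... | focusᴸ Gᵀ _ _ tr _ = ∀ₗ {G = Gᵀ} a q (invert (tr {Σ = []}) d)
  invert r (∃ₗ {G} q f) with focus-left G r
  ... | focusᴸ Gᵀ _ _ tr _ =
    ∃ₗ {G = Gᵀ} q λ a a-fresh → invert (tr {Σ = []}) (f a (Fresh-Extract r a-fresh))
  invert r (∨ᵣ {G} q d) with focus-right G (λ ()) q r
  ... | focusᴿ Gᵀ _ _ _ q' tr = ∨ᵣ {G = Gᵀ} q' (invert (tr {Σ = _ ∷ _ ∷ []}) d)
  invert r (∧ᵣ {G} q d e) with focus-right G (λ ()) q r
  ... | focusᴿ Gᵀ _ _ _ q' tr =
    ∧ᵣ {G = Gᵀ} q' (invert (tr {Σ = _ ∷ []}) d) (invert (tr {Σ = _ ∷ []}) e)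
  invert r (∃ᵣ {G} a q d) with focus-right G (λ ()) q r
  ... | focusᴿ Gᵀ _ _ _ q' tr = ∃ᵣ {G = Gᵀ} a q' (invert (tr {Σ = _ ∷ _ ∷ []}) d)
  invert r (lift {G} i d)    = invert-lift G r i d
  invert r (⊃ᵣ₁ {G} q d)     = invert-⊃ᵣ₁ G r q d
  invert r (∀ᵣ₁ {G} q f)     = invert-∀ᵣ₁ G r q f
  invert r (⊃ᵣ₂ {G} q d e)   = invert-⊃ᵣ₂ G r q d e
  invert r (∀ᵣ₂ {G} q f e)   = invert-∀ᵣ₂ G r q f e

  invert-lift G r i d with position G r
  ... | before (skip r')      = lift {G = G} i (invert (skips G (skip (skip r'))) d)
  ... | before (take p r')    = lift {G = G} i (invert (skips G (skip (take p r'))) d)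
  ... | source p (carry r')   = lift {G = G} i (invert (skips G (take p (carry r'))) d)
  ... | source p (put A∈ B∈)  = lift-skip G i (invert (skips G (take p (put (there A∈) B∈))) d)
  ... | between {Gᵀ = Gᵀ} tr (carry r')  = lift {G = Gᵀ} i (invert (tr (carry (carry r'))) d)
  ... | between {Gᵀ = Gᵀ} tr (put A∈ B∈) =
    lift-skip Gᵀ i (invert (tr (carry (put (there A∈) B∈))) d)
  ... | beyond {Gᵀ = Gᵀ} tr  = lift {G = Gᵀ} i (invert tr d)

  invert-⊃ᵣ₁ G r q d with position G r
  ... | before ()
  ... | beyond {Gᵀ = Gᵀ} tr = ⊃ᵣ₁ {G = Gᵀ} q (invert tr d)
  ... | between {Gᵀ = Gᵀ} tr (put A∈ B∈) =
    ⊃ᵣ₁-skip Gᵀ q (invert (tr (carry (carry (put A∈ B∈)))) d) (invert (tr (carry (put A∈ B∈))) d)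
  ... | source p (put A∈ B∈) with ∷-↭-∷⁻ (↭-trans (↭-sym p) q)
  ...   | inj₁ (refl , Δ↭Δ')   = weaken-⊃ᵣ-premise G (↭-sym Δ↭Δ') A∈ B∈ d
  ...   | inj₂ (_ , Δ↭ , Δ'↭) =
    ⊃ᵣ₁-skip G Δ↭ (invert (skips G (take Δ'↭ (carry (put A∈ B∈)))) d)
                  (invert (skips G (take Δ'↭ (put A∈ B∈))) d)

  invert-∀ᵣ₁ G r q f with position G r
  ... | before ()
  ... | beyond {Gᵀ = Gᵀ} tr =
    ∀ᵣ₁ {G = Gᵀ} q λ a a-fresh → invert tr (f a (Fresh-Extract r a-fresh))
  ... | between {Gᵀ = Gᵀ} tr (put A∈ B∈) =
    ∀ᵣ₁-skip Gᵀ q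
      (λ a a-fresh → invert (tr (carry (carry (put A∈ B∈)))) (f a (Fresh-Extract r a-fresh)))
      (λ a a-fresh → invert (tr (carry (put A∈ B∈))) (f a (Fresh-Extract r a-fresh)))
  ... | source p (put A∈ B∈) with ∷-↭-∷⁻ (↭-trans (↭-sym p) q)
  ...   | inj₁ (() , _)
  ...   | inj₂ (_ , Δ↭ , Δ'↭) =
    ∀ᵣ₁-skip G Δ↭
      (λ a a-fresh → invert (skips G (take Δ'↭ (carry (put A∈ B∈))))
                            (f a (Fresh-Extract r a-fresh)))
      (λ a a-fresh → invert (skips G (take Δ'↭ (put A∈ B∈))) (f a (Fresh-Extract r a-fresh)))

  invert-⊃ᵣ₂ G r q d e with position G r
  ... | before (skip r')   =
    ⊃ᵣ₂ {G = G} q (invert (skips G (skip (skip (skip r')))) d)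
                  (invert (skips G (skip (skip r'))) e)
  ... | before (take p r') =
    ⊃ᵣ₂ {G = G} q (invert (skips G (skip (skip (take p r')))) d)
                  (invert (skips G (skip (take (↭∷-++ˡ (_ ∷ []) p) r'))) e)
  ... | beyond {Gᵀ = Gᵀ} tr = ⊃ᵣ₂ {G = Gᵀ} q (invert tr d) (invert tr e)
  ... | between {Gᵀ = Gᵀ} tr (carry r') =
    ⊃ᵣ₂ {G = Gᵀ} q (invert (tr (carry (carry (carry r')))) d) (invert (tr (carry (carry r'))) e)
  ... | between {Gᵀ = Gᵀ} tr (put A∈ B∈) =
    ⊃ᵣ₂-skip Gᵀ q (invert (tr (carry (carry (put A∈ B∈)))) d)
                  (invert (tr (carry (put A∈ B∈))) d) (invert (tr (carry (put A∈ B∈))) e)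
  ... | source p r' with ∷-↭-∷⁻ (↭-trans (↭-sym p) q) | r'
  ...   | inj₁ (refl , Δ↭Δ') | carry r'' =
    exchangeᴿ G (↭-sym Δ↭Δ') (invert (skips G (skip (take ↭-refl r''))) e)
  ...   | inj₁ (refl , Δ↭Δ') | put A∈ B∈ = weaken-⊃ᵣ-premise G (↭-sym Δ↭Δ') A∈ B∈ d
  ...   | inj₂ (_ , Δ↭ , Δ'↭) | carry r'' =
    ⊃ᵣ₂ {G = G} Δ↭ (invert (skips G (take Δ'↭ (carry (carry r'')))) d)
                   (invert (skips G (take Δ'↭ (carry r''))) e)
  ...   | inj₂ (_ , Δ↭ , Δ'↭) | put A∈ B∈ =
    ⊃ᵣ₂-skip G Δ↭ (invert (skips G (take Δ'↭ (carry (put A∈ B∈)))) d)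
                  (invert (skips G (take Δ'↭ (put A∈ B∈))) d)
                  (invert (skips G (take Δ'↭ (put A∈ B∈))) e)

  invert-∀ᵣ₂ G r q f e with position G r
  ... | before (skip r')   =
    ∀ᵣ₂ {G = G} q
      (λ a a-fresh → invert (skips G (skip (skip (skip r')))) (f a (Fresh-Extract r a-fresh)))
      (invert (skips G (skip (skip r'))) e)
  ... | before (take p r') =
    ∀ᵣ₂ {G = G} q
      (λ a a-fresh → invert (skips G (skip (skip (take p r')))) (f a (Fresh-Extract r a-fresh)))
      (invert (skips G (skip (take (↭∷-++ˡ (_ ∷ []) p) r'))) e)
  ... | beyond {Gᵀ = Gᵀ} tr =
    ∀ᵣ₂ {G = Gᵀ} q (λ a a-fresh → invert tr (f a (Fresh-Extract r a-fresh))) (invert tr e)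
  ... | between {Gᵀ = Gᵀ} tr (carry r') =
    ∀ᵣ₂ {G = Gᵀ} q
      (λ a a-fresh → invert (tr (carry (carry (carry r')))) (f a (Fresh-Extract r a-fresh)))
      (invert (tr (carry (carry r'))) e)
  ... | between {Gᵀ = Gᵀ} tr (put A∈ B∈) =
    ∀ᵣ₂-skip Gᵀ q
      (λ a a-fresh → invert (tr (carry (carry (put A∈ B∈)))) (f a (Fresh-Extract r a-fresh)))
      (λ a a-fresh → invert (tr (carry (put A∈ B∈))) (f a (Fresh-Extract r a-fresh)))
      (invert (tr (carry (put A∈ B∈))) e)
  ... | source p r' with ∷-↭-∷⁻ (↭-trans (↭-sym p) q) | r'
  ...   | inj₁ (() , _) | _
  ...   | inj₂ (_ , Δ↭ , Δ'↭) | carry r'' =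
    ∀ᵣ₂ {G = G} Δ↭
      (λ a a-fresh → invert (skips G (take Δ'↭ (carry (carry r''))))
                            (f a (Fresh-Extract r a-fresh)))
      (invert (skips G (take Δ'↭ (carry r''))) e)
  ...   | inj₂ (_ , Δ↭ , Δ'↭) | put A∈ B∈ =
    ∀ᵣ₂-skip G Δ↭
      (λ a a-fresh → invert (skips G (take Δ'↭ (carry (put A∈ B∈))))
                            (f a (Fresh-Extract r a-fresh)))
      (λ a a-fresh → invert (skips G (take Δ'↭ (put A∈ B∈))) (f a (Fresh-Extract r a-fresh)))
      (invert (skips G (take Δ'↭ (put A∈ B∈))) e)

lemma12 : ∀ (G : LNS) (Γ Δ : List Fm) (A B : Fm) →
    LNIF (G ++ (Γ , (A ⊃ B) ∷ Δ) ∷ []) →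
    LNIF (G ++ (Γ , Δ) ∷ (A ∷ [] , B ∷ []) ∷ [])
lemma12 G Γ Δ A B d =
  LNIF∀⇒LNIF (invert (skips G (take ↭-refl (put (here refl) (here refl)))) (LNIF⇒LNIF∀ d))
  where open Inversion A B
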